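{- Let $\mathcal{F}\subseteq\Sigma^*$ be a finite family of strings, $k\ge0$ an integer, and $(N(F))_{F\in\mathcal{F}}$ a $k$-complete family. Then for all $F_1,F_2\in\mathcal{F}$ and every integer $0\le d\le k$, $$\mathrm{LCP}_d(F_1,F_2)=\max_{\substack{d_1+d_2=d\\ F_i'\in N_{d,d_i}(F_i)}}\mathrm{LCP}(F_1',F_2')=\max_{\substack{\lfloor d_1+d_2\rfloor\le d\\ F_i'\in N_{k,d_i}(F_i)}}\mathrm{LCP}(F_1',F_2'),$$ where $d_1,d_2$ range over non-negative half-integers.
   Context: $\Sigma_\$=\Sigma\cup\{\$\}$ with $\$\notin\Sigma$. For equal-length strings, $d_H(U,V)=|\{i:U[i]\ne V[i]\}|$ (so a $\$$ never equals a letter of $\Sigma$). $\mathrm{LCP}(U,V)$ is the longest common prefix length and $\mathrm{LCP}_d(U,V)=\max\{p\le|U|,|V| : d_H(U[1..p],V[1..p])\le d\}$. For $U,V\in\Sigma^*$ and integer $d\ge0$, strings $U',V'\in\Sigma_\$^*$ form a $(U,V)_d$-pair if $|U'|=|U|$, $|V'|=|V|$; for every $i$ with $i>\mathrm{LCP}_d(U,V)$ or $U[i]=V[i]$ we have $U'[i]=U[i]$ and $V'[i]=V[i]$; and for all other $i$, $U'[i]=V'[i]\in\{U[i],V[i],\$\}$. Sets $N(F)\subseteq\Sigma_\$^*$, $F\in\mathcal{F}$, form a $k$-complete family if for all $U,V\in\mathcal{F}$ and $0\le d\le k$ there is a $(U,V)_d$-pair $(U',V')$ with $U'\in N(U)$,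 $V'\in N(V)$. For $F\in\mathcal{F}$ and $0\le d\le k$, $N_d(F)=\{F'\in N(F): |F'|=|F|,\ d_H(F,F')\le d\}$, and for a half-integer $d'$ with $0\le d'\le d$, $N_{d,d'}(F)=\{F'\in N_d(F): d_H(F,F')-\tfrac12\#_\$(F')\le d'\}$, where $\#_\$(F')$ is the number of occurrences of $\$$ in $F'$. A half-integer is an element of $\tfrac12\mathbb{Z}$. -}

module Defs where

open import Data.Nat using (ℕ; zero; suc; _+_; _*_; _≤_; _<_; _≤?_; _⊔_; _⊓_)
open import Data.Nat.DivMod using (_/_)
open import Data.List using (List; []; _∷_; length; map; take; foldr; upTo)
open import Data.List.Membership.Propositional using (_∈_)
open import Data.Maybe using (Maybe; just; nothing)
open import Data.Product using (_×_; ∃-syntax)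
open import Data.Sum using (_⊎_)
open import Data.Bool using (if_then_else_)
open import Relation.Nullary using (¬_; does)
open import Relation.Binary.Definitions using (DecidableEquality)
open import Relation.Binary.PropositionalEquality using (_≡_)

_!?_ : {A : Set} → List A → ℕ → Maybe A
[] !? _ = nothing
(x ∷ xs) !? zero = just x
(x ∷ xs) !? suc i = xs !? i

module Strings {Σ : Set} (_≟_ : DecidableEquality Σ) where

  -- Σ_$ = Maybe Σ, where nothing plays the role of the symbol $.
  Σ$ : Set
  Σ$ = Maybe Σ

  _≟$_ : DecidableEquality Σ$
  nothing ≟$ nothing = Relation.Nullary.yes Relation.Binary.PropositionalEquality.refl
  nothing ≟$ just _ = Relation.Nullary.no (λ ())
  just _ ≟$ nothing = Relation.Nullary.no (λ ())
  just a ≟$ just b with a ≟ b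
  ... | Relation.Nullary.yes Relation.Binary.PropositionalEquality.refl = Relation.Nullary.yes Relation.Binary.PropositionalEquality.refl
  ... | Relation.Nullary.no a≢b = Relation.Nullary.no (λ { Relation.Binary.PropositionalEquality.refl → a≢b Relation.Binary.PropositionalEquality.refl })

  ι : List Σ → List Σ$
  ι = map just

  -- Hamming distance (intended for equal-length strings; counts mismatching positions)
  dHgen : {A : Set} → DecidableEquality A → List A → List A → ℕ
  dHgen eq [] _ = 0
  dHgen eq (_ ∷ _) [] = 0
  dHgen eq (a ∷ u) (b ∷ v) = (if does (eq a b) then 0 else 1) + dHgen eq u v

  dH : List Σ → List Σ → ℕ
  dH = dHgen _≟_

  dH$ : List Σ$ → List Σ$ → ℕ
  dH$ = dHgen _≟$_

  #$ : List Σ$ → ℕ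
  #$ [] = 0
  #$ (nothing ∷ u) = suc (#$ u)
  #$ (just _ ∷ u) = #$ u

  LCP : List Σ$ → List Σ$ → ℕ
  LCP [] _ = 0
  LCP (_ ∷ _) [] = 0
  LCP (a ∷ u) (b ∷ v) = if does (a ≟$ b) then suc (LCP u v) else 0

  LCPd : ℕ → List Σ → List Σ → ℕ
  LCPd d U V =
    foldr _⊔_ 0
      (map (λ p → if does (dH (take p U) (take p V) ≤? d) then p else 0)
           (upTo (suc (length U ⊓ length V))))

  -- (U,V)_d-pair (positions are 0-based here: 1-based i > LCP_d  ⇔  0-based i ≥ LCP_d)
  IsPair : ℕ → List Σ → List Σ → List Σ$ → List Σ$ → Set
  IsPair d U V U' V' =
    length U' ≡ length U × length V' ≡ length V
    × (∀ i → (LCPd d U V ≤ i ⊎ U !? i ≡ V !? i) →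
         (U' !? i ≡ ι U !? i) × (V' !? i ≡ ι V !? i))
    × (∀ i → i < LCPd d U V → ¬ (U !? i ≡ V !? i) →
         (U' !? i ≡ V' !? i)
         × (U' !? i ≡ ι U !? i ⊎ U' !? i ≡ ι V !? i ⊎ U' !? i ≡ just nothing))

  KComplete : (𝓕 : List (List Σ)) → ℕ → (List Σ → List Σ$ → Set) → Set
  KComplete 𝓕 k N =
    ∀ U V → U ∈ 𝓕 → V ∈ 𝓕 → ∀ d → d ≤ k →
      ∃[ U' ] ∃[ V' ] (IsPair d U V U' V' × N U U' × N V V')

  Nd : (List Σ → List Σ$ → Set) → ℕ → List Σ → List Σ$ → Set
  Nd N d F F' = N F F' × length F' ≡ length F × dH$ (ι F) F' ≤ d

  -- F' ∈ N_{d,d'}(F) with the half-integer d' = h/2 (h : ℕ):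
  -- d_H(F,F') - #$(F')/2 ≤ h/2  ⇔  2·d_H(F,F') ≤ h + #$(F')
  Ndh : (List Σ → List Σ$ → Set) → ℕ → ℕ → List Σ → List Σ$ → Set
  Ndh N d h F F' = Nd N d F F' × 2 * dH$ (ι F) F' ≤ h + #$ F'

IsMax : (ℕ → Set) → ℕ → Set
IsMax P m = P m × (∀ n → P n → n ≤ m)

module Submission where

-- Half-integers are
-- represented by their doubles h_i = 2·d_i, so ⌊d₁ + d₂⌋ ≤ d reads (h₁ + h₂)/2 ≤ d.
--
-- Along the common prefix of F₁', F₂' both strings show the
-- same symbol x at each position; if F₁, F₂ differ there, or x = $, then x differs from F₁ or
-- from F₂ (`position-bound`).  Summing (`prefix-bound`) gives
--   2·d_H(F₁[..ℓ], F₂[..ℓ]) + #$(F₁') + #$(F₂') ≤ 2·d_H(F₁,F₁') + 2·d_H(F₂,F₂'),  ℓ = LCP(F₁',F₂'),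
-- and the budgets 2·d_H(F_i,F_i') ≤ h_i + #$(F_i') turn this into 2·d_H(F₁[..ℓ],F₂[..ℓ]) ≤ h₁+h₂,
-- so ℓ is an admissible length for LCP_d as soon as h₁ + h₂ ≤ 2d + 1.
--
-- Lower bound (`optimal-witness`).  k-completeness provides a (F₁,F₂)_d-pair (F₁',F₂').  Counting
-- its mismatch positions by which symbol they show (`decompose`) splits the costs as
-- d_H(F₁,F₁') = a + c, d_H(F₂,F₂') = b + c with c dollars on each side and a + b + c ≤ d; the
-- budgets h₁ = 2a + c, h₂ = 2d − h₁ then work (`split-budget`), and the upper bound forces
-- LCP(F₁',F₂') = LCP_d(F₁,F₂).  The relaxed maximum follows by monotonicity in d ≤ k.

open import Defs
open import Data.Nat using (ℕ; zero; suc; _+_; _*_; _∸_; _≤_; _<_; _≤?_; _⊔_; _⊓_; z≤n; s≤s)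
open import Data.Nat.Properties
open import Data.Nat.DivMod using (_/_; _%_; m≡m%n+[m/n]*n; m%n<n; m*n/n≡m)
open import Data.Nat.Solver using (module +-*-Solver)
open import Data.List using (List; []; _∷_; length; take; foldr; upTo)
open import Data.List.Properties using (foldr-preservesᵇ; foldr-preservesᵒ)
open import Data.List.Membership.Propositional using (_∈_)
open import Data.List.Membership.Propositional.Properties using (∈-map⁺; ∈-upTo⁺)
open import Data.List.Relation.Unary.All as All using (All)
open import Data.List.Relation.Unary.All.Properties using (all-upTo; map⁺)
import Data.List.Relation.Unary.Any as Any
open import Data.Maybe using (Maybe; just; nothing)
open import Data.Maybe.Properties using (just-injective)
open import Data.Bool using (if_then_else_)
open import Data.Product using (_×_; _,_; proj₁; proj₂; ∃-syntax) renaming (map to ×-map)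
open import Data.Sum using (_⊎_; inj₁; inj₂; [_,_]′; map₁)
open import Function using (_∘_)
open import Relation.Nullary using (Dec; yes; no; does; ¬_; contradiction)
open import Relation.Nullary.Decidable using (dec-true; dec-false)
open import Relation.Binary.Definitions using (DecidableEquality)
open import Relation.Binary.PropositionalEquality
open +-*-Solver

halve : ∀ m d → 2 * m ≤ suc (2 * d) → m ≤ d
halve m d 2m≤ = ≤-pred (*-cancelˡ-< 2 m (suc d) 2m<)
  where
  2m< : suc (2 * m) ≤ 2 * suc d
  2m< = subst (suc (2 * m) ≤_) (sym (*-suc 2 d)) (s≤s 2m≤)

floor-half-bound : ∀ n d → n / 2 ≤ d → n ≤ suc (2 * d)
floor-half-bound n d n/2≤d = begin
  n                    ≡⟨ m≡m%n+[m/n]*n n 2 ⟩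
  n % 2 + (n / 2) * 2  ≤⟨ +-mono-≤ (≤-pred (m%n<n n 2)) (*-monoˡ-≤ 2 n/2≤d) ⟩
  1 + d * 2            ≡⟨ cong suc (*-comm d 2) ⟩
  suc (2 * d)          ∎
  where open ≤-Reasoning

half-of-double : ∀ d → (2 * d) / 2 ≡ d
half-of-double d = trans (cong (_/ 2) (*-comm 2 d)) (m*n/n≡m d 2)

split-budget : ∀ a b c d → a + b + c ≤ d →
  ∃[ h₁ ] ∃[ h₂ ] (h₁ + h₂ ≡ 2 * d × 2 * (a + c) ≤ h₁ + c × 2 * (b + c) ≤ h₂ + c)
split-budget a b c d abc≤d = h₁ , 2 * d ∸ h₁ , m+[n∸m]≡n h₁≤2d , ≤-reflexive first , second
  where
  h₁ : ℕ
  h₁ = 2 * a + c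
  first : 2 * (a + c) ≡ h₁ + c
  first = solve 2 (λ a c → con 2 :* (a :+ c) := (con 2 :* a :+ c) :+ c) refl a c
  both≤ : (2 * b + c) + h₁ ≤ 2 * d
  both≤ = begin
    (2 * b + c) + h₁     ≡⟨ solve 3 (λ a b c → (con 2 :* b :+ c) :+ (con 2 :* a :+ c)
                                             := con 2 :* (a :+ b :+ c)) refl a b c ⟩
    2 * (a + b + c)      ≤⟨ *-monoʳ-≤ 2 abc≤d ⟩
    2 * d                ∎
    where open ≤-Reasoning
  h₁≤2d : h₁ ≤ 2 * d
  h₁≤2d = m+n≤o⇒n≤o (2 * b + c) both≤
  second : 2 * (b + c) ≤ (2 * d ∸ h₁) + c
  second = begin
    2 * (b + c)          ≡⟨ solve 2 (λ b c → con 2 :* (b :+ c) := (con 2 :* b :+ c) :+ c) refl b c ⟩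
    (2 * b + c) + c      ≤⟨ +-monoˡ-≤ c (m+n≤o⇒m≤o∸n (2 * b + c) both≤) ⟩
    (2 * d ∸ h₁) + c     ∎
    where open ≤-Reasoning

-- One more aligned position extends the doubled-cost inequality of `prefix-bound`.
cons-step : ∀ x s e₁ e₂ D p q E₁ E₂ → x + s ≤ e₁ + e₂ → 2 * D + (p + q) ≤ 2 * E₁ + 2 * E₂ →
  2 * (x + D) + ((s + p) + (s + q)) ≤ 2 * (e₁ + E₁) + 2 * (e₂ + E₂)
cons-step x s e₁ e₂ D p q E₁ E₂ head tail = begin
  2 * (x + D) + ((s + p) + (s + q))
    ≡⟨ solve 5 (λ x s D p q → con 2 :* (x :+ D) :+ ((s :+ p) :+ (s :+ q))
                            := con 2 :* (x :+ s) :+ (con 2 :* D :+ (p :+ q))) refl x s D p q ⟩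
  2 * (x + s) + (2 * D + (p + q))
    ≤⟨ +-mono-≤ (*-monoʳ-≤ 2 head) tail ⟩
  2 * (e₁ + e₂) + (2 * E₁ + 2 * E₂)
    ≡⟨ solve 4 (λ e₁ e₂ E₁ E₂ → con 2 :* (e₁ :+ e₂) :+ (con 2 :* E₁ :+ con 2 :* E₂)
                              := con 2 :* (e₁ :+ E₁) :+ con 2 :* (e₂ :+ E₂)) refl e₁ e₂ E₁ E₂ ⟩
  2 * (e₁ + E₁) + 2 * (e₂ + E₂) ∎
  where open ≤-Reasoning

max-preserves : (P : ℕ → Set) {xs : List ℕ} → P 0 → All P xs → P (foldr _⊔_ 0 xs)
max-preserves P = foldr-preservesᵇ {P = P} choose
  where
  choose : ∀ {x y} → P x → P y → P (x ⊔ y)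
  choose {x} {y} px py =
    [ (λ e → subst P (sym e) px) , (λ e → subst P (sym e) py) ]′ (⊔-sel x y)

≤-max : ∀ {x} xs → x ∈ xs → x ≤ foldr _⊔_ 0 xs
≤-max {x} xs x∈xs = foldr-preservesᵒ {P = x ≤_} step 0 xs (inj₂ (Any.map ≤-reflexive x∈xs))
  where
  step : ∀ y z → x ≤ y ⊎ x ≤ z → x ≤ y ⊔ z
  step y z = [ m≤n⇒m≤n⊔o z , m≤n⇒m≤o⊔n y ]′

keep-if : {P : Set} → Dec P → ℕ → ℕ
keep-if q p = if does q then p else 0

keep-if-yes : ∀ {P : Set} (q : Dec P) {p} → P → keep-if q p ≡ p
keep-if-yes (yes _) _ = refl
keep-if-yes (no ¬p) p = contradiction p ¬p

keep-if-elim : ∀ {P : Set} (Q : ℕ → Set) (q : Dec P) {p} → (P → Q p) → Q 0 → Q (keep-if q p)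
keep-if-elim Q (yes x) yes-case _ = yes-case x
keep-if-elim Q (no _) _ no-case = no-case

!?-ext : {A : Set} (xs ys : List A) → (∀ i → xs !? i ≡ ys !? i) → xs ≡ ys
!?-ext [] [] _ = refl
!?-ext [] (y ∷ ys) same with same 0
... | ()
!?-ext (x ∷ xs) [] same with same 0
... | ()
!?-ext (x ∷ xs) (y ∷ ys) same =
  cong₂ _∷_ (just-injective (same 0)) (!?-ext xs ys (λ i → same (suc i)))

module Mismatch {A : Set} (eq : DecidableEquality A) where

  mismatch : A → A → ℕ
  mismatch a b = if does (eq a b) then 0 else 1

  mismatch-refl : ∀ a → mismatch a a ≡ 0
  mismatch-refl a rewrite dec-true (eq a a) refl = refl

  mismatch-distinct : ∀ {a b} → ¬ a ≡ b → mismatch a b ≡ 1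
  mismatch-distinct {a} {b} a≢b rewrite dec-false (eq a b) a≢b = refl

  mismatch≤1 : ∀ a b → mismatch a b ≤ 1
  mismatch≤1 a b with eq a b
  ... | yes _ = z≤n
  ... | no _ = s≤s z≤n

  mismatch-triangle : ∀ a b c → mismatch a b ≤ mismatch a c + mismatch b c
  mismatch-triangle a b c with eq a b | eq a c | eq b c
  ... | yes _ | _ | _ = z≤n
  ... | no _ | no _ | _ = s≤s z≤n
  ... | no _ | yes _ | no _ = s≤s z≤n
  ... | no a≢b | yes refl | yes refl = contradiction refl a≢b

module StringLemmas {Σ : Set} (_≟_ : DecidableEquality Σ) where
  open Strings _≟_
  open Mismatch using (mismatch; mismatch-refl; mismatch-distinct; mismatch≤1; mismatch-triangle)

  -- The characterisation of LCP_d

  Admissible : ℕ → List Σ → List Σ → ℕ → Set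
  Admissible d U V p = p ≤ length U × p ≤ length V × dH (take p U) (take p V) ≤ d

  LCPd-admissible : ∀ d U V → Admissible d U V (LCPd d U V)
  LCPd-admissible d U V =
    max-preserves (Admissible d U V) (z≤n , z≤n , z≤n) (map⁺ (All.map candidate (all-upTo _)))
    where
    candidate : ∀ {p} → p < suc (length U ⊓ length V) →
      Admissible d U V (keep-if (dH (take p U) (take p V) ≤? d) p)
    candidate {p} p< = keep-if-elim (Admissible d U V) (dH (take p U) (take p V) ≤? d)
      (λ within → ≤-trans (≤-pred p<) (m⊓n≤m _ _) , ≤-trans (≤-pred p<) (m⊓n≤n _ _) , within)
      (z≤n , z≤n , z≤n)

  LCPd-maximal : ∀ d U V p → Admissible d U V p → p ≤ LCPd d U V
  LCPd-maximal d U V p (p≤U , p≤V , within) =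
    subst (_≤ LCPd d U V) (keep-if-yes (dH (take p U) (take p V) ≤? d) within)
      (≤-max _ (∈-map⁺ (λ q → keep-if (dH (take q U) (take q V) ≤? d) q) (∈-upTo⁺ (s≤s (⊓-glb p≤U p≤V)))))

  dollar : Σ$ → ℕ
  dollar nothing = 1
  dollar (just _) = 0

  #$-∷ : ∀ x u → #$ (x ∷ u) ≡ dollar x + #$ u
  #$-∷ nothing u = refl
  #$-∷ (just _) u = refl

  #$-ι : ∀ U → #$ (ι U) ≡ 0
  #$-ι [] = refl
  #$-ι (a ∷ U) = #$-ι U

  mismatch-just : ∀ a b → mismatch _≟$_ (just a) (just b) ≡ mismatch _≟_ a b
  mismatch-just a b with a ≟ b
  ... | yes refl = refl
  ... | no _ = refl

  dH$-refl : ∀ U → dH$ (ι U) (ι U) ≡ 0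
  dH$-refl [] = refl
  dH$-refl (a ∷ U) = cong₂ _+_ (mismatch-refl _≟$_ (just a)) (dH$-refl U)

  LCP-∷ : ∀ x u v → LCP (x ∷ u) (x ∷ v) ≡ suc (LCP u v)
  LCP-∷ x u v rewrite dec-true (x ≟$ x) refl = refl

  LCP≤lengths : ∀ u v → LCP u v ≤ length u × LCP u v ≤ length v
  LCP≤lengths [] v = z≤n , z≤n
  LCP≤lengths (x ∷ u) [] = z≤n , z≤n
  LCP≤lengths (x ∷ u) (y ∷ v) with x ≟$ y
  ... | yes _ = ×-map s≤s s≤s (LCP≤lengths u v)
  ... | no _ = z≤n , z≤n

  -- The upper bound

  -- Each $ in a modification F' of F is itself a modified position.
  #$≤dH$ : ∀ U U' → length U' ≡ length U → #$ U' ≤ dH$ (ι U) U'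
  #$≤dH$ [] [] _ = z≤n
  #$≤dH$ [] (_ ∷ _) ()
  #$≤dH$ (_ ∷ _) [] ()
  #$≤dH$ (a ∷ U) (nothing ∷ U') e = s≤s (#$≤dH$ U U' (suc-injective e))
  #$≤dH$ (a ∷ U) (just c ∷ U') e = ≤-trans (#$≤dH$ U U' (suc-injective e)) (m≤n+m _ _)

  -- Off the common prefix only the dollars are counted, and each is a modification.
  dollars-bound : ∀ U V U' V' → length U' ≡ length U → length V' ≡ length V →
    #$ U' + #$ V' ≤ 2 * dH$ (ι U) U' + 2 * dH$ (ι V) V'
  dollars-bound U V U' V' lu lv =
    +-mono-≤ (≤-trans (#$≤dH$ U U' lu) (m≤m+n _ _)) (≤-trans (#$≤dH$ V V' lv) (m≤m+n _ _))

  -- At an aligned position showing x: a mismatch between a and b, or a $, is paid for by x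
  -- differing from a or from b.
  position-bound : ∀ a b x →
    mismatch _≟_ a b + dollar x ≤ mismatch _≟$_ (just a) x + mismatch _≟$_ (just b) x
  position-bound a b nothing = +-monoˡ-≤ 1 (mismatch≤1 _≟_ a b)
  position-bound a b (just c) =
    subst₂ _≤_ (sym (+-identityʳ _)) (sym (cong₂ _+_ (mismatch-just a c) (mismatch-just b c)))
      (mismatch-triangle _≟_ a b c)

  -- Summing `position-bound` along the common prefix, and `#$≤dH$` beyond it.
  prefix-bound : ∀ U V U' V' → length U' ≡ length U → length V' ≡ length V →
    2 * dH (take (LCP U' V') U) (take (LCP U' V') V) + (#$ U' + #$ V')
      ≤ 2 * dH$ (ι U) U' + 2 * dH$ (ι V) V'
  prefix-bound U V [] V' lu lv = dollars-bound U V [] V' lu lv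
  prefix-bound U V (x ∷ U') [] lu lv = dollars-bound U V (x ∷ U') [] lu lv
  prefix-bound [] V (x ∷ U') (y ∷ V') () lv
  prefix-bound (a ∷ U) [] (x ∷ U') (y ∷ V') lu ()
  prefix-bound (a ∷ U) (b ∷ V) (x ∷ U') (y ∷ V') lu lv with x ≟$ y
  ... | no _ = dollars-bound (a ∷ U) (b ∷ V) (x ∷ U') (y ∷ V') lu lv
  ... | yes refl =
    subst (λ n → 2 * (mismatch _≟_ a b + D) + n ≤ 2 * (e₁ + E₁) + 2 * (e₂ + E₂))
      (sym (cong₂ _+_ (#$-∷ x U') (#$-∷ x V')))
      (cons-step (mismatch _≟_ a b) (dollar x) e₁ e₂ D (#$ U') (#$ V') E₁ E₂
        (position-bound a b x) (prefix-bound U V U' V' (suc-injective lu) (suc-injective lv)))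
    where
    D e₁ e₂ E₁ E₂ : ℕ
    D = dH (take (LCP U' V') U) (take (LCP U' V') V)
    e₁ = mismatch _≟$_ (just a) x
    e₂ = mismatch _≟$_ (just b) x
    E₁ = dH$ (ι U) U'
    E₂ = dH$ (ι V) V'

  LCP-upper-bound : ∀ {N : List Σ → List Σ$ → Set} {e₁ e₂ h₁ h₂} d F₁ F₂ F₁' F₂' →
    h₁ + h₂ ≤ suc (2 * d) → Ndh N e₁ h₁ F₁ F₁' → Ndh N e₂ h₂ F₂ F₂' →
    LCP F₁' F₂' ≤ LCPd d F₁ F₂
  LCP-upper-bound {h₁ = h₁} {h₂} d F₁ F₂ F₁' F₂' budget
    ((_ , len₁ , _) , cost₁) ((_ , len₂ , _) , cost₂) =
    LCPd-maximal d F₁ F₂ ℓ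
      ( ≤-trans (proj₁ (LCP≤lengths F₁' F₂')) (≤-reflexive len₁)
      , ≤-trans (proj₂ (LCP≤lengths F₁' F₂')) (≤-reflexive len₂)
      , halve _ d (+-cancelʳ-≤ (#$ F₁' + #$ F₂') _ _ doubled))
    where
    ℓ : ℕ
    ℓ = LCP F₁' F₂'
    open ≤-Reasoning
    doubled : 2 * dH (take ℓ F₁) (take ℓ F₂) + (#$ F₁' + #$ F₂') ≤ suc (2 * d) + (#$ F₁' + #$ F₂')
    doubled = begin
      2 * dH (take ℓ F₁) (take ℓ F₂) + (#$ F₁' + #$ F₂')  ≤⟨ prefix-bound F₁ F₂ F₁' F₂' len₁ len₂ ⟩
      2 * dH$ (ι F₁) F₁' + 2 * dH$ (ι F₂) F₂'            ≤⟨ +-mono-≤ cost₁ cost₂ ⟩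
      (h₁ + #$ F₁') + (h₂ + #$ F₂')
        ≡⟨ solve 4 (λ h₁ h₂ p q → (h₁ :+ p) :+ (h₂ :+ q) := (h₁ :+ h₂) :+ (p :+ q))
                   refl h₁ h₂ (#$ F₁') (#$ F₂') ⟩
      (h₁ + h₂) + (#$ F₁' + #$ F₂')                       ≤⟨ +-monoˡ-≤ _ budget ⟩
      suc (2 * d) + (#$ F₁' + #$ F₂')                     ∎

  -- The lower bound

  -- The conditions of a (U,V)_d-pair with LCP_d(U,V) replaced by an arbitrary length L;
  -- IsPair d U V U' V' is PairUpTo (LCPd d U V) U V U' V'.
  PairUpTo : ℕ → List Σ → List Σ → List Σ$ → List Σ$ → Set
  PairUpTo L U V U' V' =
    length U' ≡ length U × length V' ≡ length V
    × (∀ i → (L ≤ i ⊎ U !? i ≡ V !? i) →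
         (U' !? i ≡ ι U !? i) × (V' !? i ≡ ι V !? i))
    × (∀ i → i < L → ¬ (U !? i ≡ V !? i) →
         (U' !? i ≡ V' !? i)
         × (U' !? i ≡ ι U !? i ⊎ U' !? i ≡ ι V !? i ⊎ U' !? i ≡ just nothing))

  tail-pair : ∀ {L a b x y U V U' V'} →
    PairUpTo (suc L) (a ∷ U) (b ∷ V) (x ∷ U') (y ∷ V') → PairUpTo L U V U' V'
  tail-pair (lu , lv , outside , inside) =
    suc-injective lu , suc-injective lv ,
    (λ i h → outside (suc i) (map₁ s≤s h)) ,
    (λ i i<L ne → inside (suc i) (s≤s i<L) ne)

  -- The mismatch positions i < L of a pair, sorted by the symbol both strings show there:
  -- V[i] (U' moved towards V), U[i] (V' moved towards U), or $.
  record Decomposition (L : ℕ) (U V : List Σ) (U' V' : List Σ$) : Set where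
    field
      towardV towardU dollars : ℕ
      costU : dH$ (ι U) U' ≡ towardV + dollars
      costV : dH$ (ι V) V' ≡ towardU + dollars
      dollarsU : #$ U' ≡ dollars
      dollarsV : #$ V' ≡ dollars
      within : towardV + towardU + dollars ≤ dH (take L U) (take L V)
      agree : L ≤ LCP U' V'

  unchanged : ∀ {U V U' V'} → U' ≡ ι U → V' ≡ ι V → Decomposition 0 U V U' V'
  unchanged {U} {V} refl refl = record
    { towardV = 0 ; towardU = 0 ; dollars = 0
    ; costU = dH$-refl U ; costV = dH$-refl V ; dollarsU = #$-ι U ; dollarsV = #$-ι V
    ; within = z≤n ; agree = z≤n }

  mismatch-step : ∀ {a b n D} → ¬ a ≡ b → n ≤ D → suc n ≤ mismatch _≟_ a b + D
  mismatch-step a≢b n≤D = ≤-trans (s≤s n≤D) (≤-reflexive (sym (cong (_+ _) (mismatch-distinct _≟_ a≢b))))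

  module _ {L U V U' V'} (r : Decomposition L U V U' V') where
    open Decomposition r

    agree-∷ : ∀ x → suc L ≤ LCP (x ∷ U') (x ∷ V')
    agree-∷ x = subst (suc L ≤_) (sym (LCP-∷ x U' V')) (s≤s agree)

    extend-agree : ∀ a → Decomposition (suc L) (a ∷ U) (a ∷ V) (just a ∷ U') (just a ∷ V')
    extend-agree a = record
      { towardV = towardV ; towardU = towardU ; dollars = dollars
      ; costU = trans (cong (_+ _) (mismatch-refl _≟$_ (just a))) costU
      ; costV = trans (cong (_+ _) (mismatch-refl _≟$_ (just a))) costV
      ; dollarsU = dollarsU ; dollarsV = dollarsV
      ; within = ≤-trans within (m≤n+m _ _) ; agree = agree-∷ (just a) }

    extend-towardU : ∀ {a b} → ¬ a ≡ b →
      Decomposition (suc L) (a ∷ U) (b ∷ V) (just a ∷ U') (just a ∷ V')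
    extend-towardU {a} {b} a≢b = record
      { towardV = towardV ; towardU = suc towardU ; dollars = dollars
      ; costU = trans (cong (_+ _) (mismatch-refl _≟$_ (just a))) costU
      ; costV = cong₂ _+_ (mismatch-distinct _≟$_ (a≢b ∘ sym ∘ just-injective)) costV
      ; dollarsU = dollarsU ; dollarsV = dollarsV
      ; within = ≤-trans (≤-reflexive (cong (_+ dollars) (+-suc towardV towardU)))
                   (mismatch-step a≢b within)
      ; agree = agree-∷ (just a) }

    extend-towardV : ∀ {a b} → ¬ a ≡ b →
      Decomposition (suc L) (a ∷ U) (b ∷ V) (just b ∷ U') (just b ∷ V')
    extend-towardV {a} {b} a≢b = record
      { towardV = suc towardV ; towardU = towardU ; dollars = dollars
      ; costU = cong₂ _+_ (mismatch-distinct _≟$_ (a≢b ∘ just-injective)) costU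
      ; costV = trans (cong (_+ _) (mismatch-refl _≟$_ (just b))) costV
      ; dollarsU = dollarsU ; dollarsV = dollarsV
      ; within = mismatch-step a≢b within
      ; agree = agree-∷ (just b) }

    extend-dollar : ∀ {a b} → ¬ a ≡ b →
      Decomposition (suc L) (a ∷ U) (b ∷ V) (nothing ∷ U') (nothing ∷ V')
    extend-dollar a≢b = record
      { towardV = towardV ; towardU = towardU ; dollars = suc dollars
      ; costU = trans (cong suc costU) (sym (+-suc towardV dollars))
      ; costV = trans (cong suc costV) (sym (+-suc towardU dollars))
      ; dollarsU = cong suc dollarsU ; dollarsV = cong suc dollarsV
      ; within = ≤-trans (≤-reflexive (+-suc (towardV + towardU) dollars))
                   (mismatch-step a≢b within)
      ; agree = agree-∷ nothing }

  decompose : ∀ L U V U' V' → L ≤ length U → L ≤ length V →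
    PairUpTo L U V U' V' → Decomposition L U V U' V'
  decompose zero U V U' V' _ _ (_ , _ , outside , _) =
    unchanged (!?-ext U' (ι U) (λ i → proj₁ (outside i (inj₁ z≤n))))
              (!?-ext V' (ι V) (λ i → proj₂ (outside i (inj₁ z≤n))))
  decompose (suc L) [] _ _ _ () _ _
  decompose (suc L) (a ∷ U) [] _ _ _ () _
  decompose (suc L) (a ∷ U) (b ∷ V) [] _ _ _ (() , _)
  decompose (suc L) (a ∷ U) (b ∷ V) (x ∷ U') [] _ _ (_ , () , _)
  decompose (suc L) (a ∷ U) (b ∷ V) (x ∷ U') (y ∷ V') (s≤s L≤U) (s≤s L≤V)
    pair@(_ , _ , outside , inside)
    with decompose L U V U' V' L≤U L≤V (tail-pair pair) | a ≟ b
  ... | r | yes refl with outside 0 (inj₂ refl)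
  ...   | refl , refl = extend-agree r a
  decompose (suc L) (a ∷ U) (b ∷ V) (x ∷ U') (y ∷ V') _ _ (_ , _ , _ , inside)
      | r | no a≢b with inside 0 (s≤s z≤n) (a≢b ∘ just-injective)
  ... | refl , inj₁ refl = extend-towardU r a≢b
  ... | refl , inj₂ (inj₁ refl) = extend-towardV r a≢b
  ... | refl , inj₂ (inj₂ refl) = extend-dollar r a≢b

  optimal-witness : ∀ {N : List Σ → List Σ$ → Set} d F₁ F₂ F₁' F₂' →
    IsPair d F₁ F₂ F₁' F₂' → N F₁ F₁' → N F₂ F₂' →
    ∃[ h₁ ] ∃[ h₂ ] (h₁ + h₂ ≡ 2 * d × Ndh N d h₁ F₁ F₁' × Ndh N d h₂ F₂ F₂'
                     × LCP F₁' F₂' ≡ LCPd d F₁ F₂)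
  optimal-witness {N} d F₁ F₂ F₁' F₂' pair@(len₁ , len₂ , _) n₁ n₂ =
    let h₁ , h₂ , sum , paid₁ , paid₂ = split-budget a b c d abc≤d
        N₁ : Ndh N d h₁ F₁ F₁'
        N₁ = (n₁ , len₁ , subst (_≤ d) (sym costU) (≤-trans (+-monoˡ-≤ c (m≤m+n a b)) abc≤d))
           , subst₂ (λ D n → 2 * D ≤ h₁ + n) (sym costU) (sym dollarsU) paid₁
        N₂ : Ndh N d h₂ F₂ F₂'
        N₂ = (n₂ , len₂ , subst (_≤ d) (sym costV) (≤-trans (+-monoˡ-≤ c (m≤n+m b a)) abc≤d))
           , subst₂ (λ D n → 2 * D ≤ h₂ + n) (sym costV) (sym dollarsV) paid₂
    in h₁ , h₂ , sum , N₁ , N₂ ,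
       ≤-antisym (LCP-upper-bound d F₁ F₂ F₁' F₂' (≤-trans (≤-reflexive sum) (n≤1+n _)) N₁ N₂) agree
    where
    admissible : Admissible d F₁ F₂ (LCPd d F₁ F₂)
    admissible = LCPd-admissible d F₁ F₂
    r : Decomposition (LCPd d F₁ F₂) F₁ F₂ F₁' F₂'
    r = decompose (LCPd d F₁ F₂) F₁ F₂ F₁' F₂' (proj₁ admissible) (proj₁ (proj₂ admissible)) pair
    open Decomposition r renaming (towardV to a; towardU to b; dollars to c)
    abc≤d : a + b + c ≤ d
    abc≤d = ≤-trans within (proj₂ (proj₂ admissible))

  Ndh-mono : ∀ N h F F' {d k} → d ≤ k → Ndh N d h F F' → Ndh N k h F F'
  Ndh-mono N h F F' d≤k ((n , len , dist) , cost) = (n , len , ≤-trans dist d≤k) , cost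

lemma12 : {Σ : Set} (_≟_ : DecidableEquality Σ) →
    let open Strings _≟_ in
    (𝓕 : List (List Σ)) (k : ℕ) (N : List Σ → List (Maybe Σ) → Set) →
    KComplete 𝓕 k N →
    ∀ F₁ F₂ → F₁ ∈ 𝓕 → F₂ ∈ 𝓕 → ∀ d → d ≤ k →
    IsMax (λ ℓ → ∃[ h₁ ] ∃[ h₂ ] ∃[ F₁' ] ∃[ F₂' ]
    (h₁ + h₂ ≡ 2 * d × Ndh N d h₁ F₁ F₁' × Ndh N d h₂ F₂ F₂'
    × LCP F₁' F₂' ≡ ℓ))
    (LCPd d F₁ F₂)
    × IsMax (λ ℓ → ∃[ h₁ ] ∃[ h₂ ] ∃[ F₁' ] ∃[ F₂' ]
    ((h₁ + h₂) / 2 ≤ d × h₁ ≤ 2 * k × h₂ ≤ 2 * k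
    × Ndh N k h₁ F₁ F₁' × Ndh N k h₂ F₂ F₂'
    × LCP F₁' F₂' ≡ ℓ))
    (LCPd d F₁ F₂)
lemma12 _≟_ 𝓕 k N complete F₁ F₂ F₁∈𝓕 F₂∈𝓕 d d≤k =
  let F₁' , F₂' , pair , n₁ , n₂ = complete F₁ F₂ F₁∈𝓕 F₂∈𝓕 d d≤k
      h₁ , h₂ , sum , N₁ , N₂ , attains = optimal-witness {N} d F₁ F₂ F₁' F₂' pair n₁ n₂
      h≤2k : ∀ {h} → h ≤ h₁ + h₂ → h ≤ 2 * k
      h≤2k h≤ = ≤-trans h≤ (≤-trans (≤-reflexive sum) (*-monoʳ-≤ 2 d≤k))
      floor≤d : (h₁ + h₂) / 2 ≤ d
      floor≤d = ≤-reflexive (trans (cong (_/ 2) sum) (half-of-double d))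
  in ( (h₁ , h₂ , F₁' , F₂' , sum , N₁ , N₂ , attains)
     , λ { _ (_ , _ , G₁ , G₂ , sum′ , M₁ , M₂ , refl) →
             LCP-upper-bound d F₁ F₂ G₁ G₂ (≤-trans (≤-reflexive sum′) (n≤1+n _)) M₁ M₂ } )
   , ( (h₁ , h₂ , F₁' , F₂' , floor≤d , h≤2k (m≤m+n h₁ h₂) , h≤2k (m≤n+m h₂ h₁)
       , Ndh-mono N h₁ F₁ F₁' d≤k N₁ , Ndh-mono N h₂ F₂ F₂' d≤k N₂ , attains)
     , λ { _ (g₁ , g₂ , G₁ , G₂ , floor≤ , _ , _ , M₁ , M₂ , refl) →
             LCP-upper-bound d F₁ F₂ G₁ G₂ (floor-half-bound (g₁ + g₂) d floor≤) M₁ M₂ } )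
  where
  open StringLemmas _≟_ using (optimal-witness; LCP-upper-bound; Ndh-mono)
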